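{- There exists a set of eight mutually orthogoval $\mathrm{AG}(3,\mathbb{F}_3)$.
   Context: $\mathrm{AG}(3,\mathbb{F}_3)$ is the $3$-dimensional affine space over the field with $3$ elements. A pair of spaces, both affine, of the same dimension and order and on the same point set (two incidence structures on a common point set, each isomorphic to the given space) are orthogoval if each line of one space intersects each line of the other space in at most two points. A set of such spaces is mutually orthogoval if every two distinct members are orthogoval. -}

module Defs where

open import Data.Fin using (Fin; zero; suc)
import Data.Fin.Properties as FinP
open import Data.Product using (_×_; _,_)
import Data.Product.Properties as ProdP
open import Data.List using (List; []; _∷_; concatMap; filter; length)
open import Data.Nat using (ℕ; _≤_)
open import Data.Sum using (_⊎_)
open import Relation.Binary.PropositionalEquality using (_≡_; _≢_)
open import Relation.Binary.Definitions using (DecidableEquality)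
open import Relation.Nullary using (Dec; ¬_)
open import Relation.Nullary.Decidable using (_×-dec_; _⊎-dec_)
open import Function.Bundles using (_↔_; Inverse)

F₃ : Set
F₃ = Fin 3

_⊕_ : F₃ → F₃ → F₃
zero ⊕ y = y
suc zero ⊕ zero = suc zero
suc zero ⊕ suc zero = suc (suc zero)
suc zero ⊕ suc (suc zero) = zero
suc (suc zero) ⊕ zero = suc (suc zero)
suc (suc zero) ⊕ suc zero = zero
suc (suc zero) ⊕ suc (suc zero) = suc zero

Point : Set
Point = F₃ × F₃ × F₃

_+ᵥ_ : Point → Point → Point
(a , b , c) +ᵥ (x , y , z) = (a ⊕ x , b ⊕ y , c ⊕ z)

𝟎 : Point
𝟎 = (zero , zero , zero)

_≟ₚ_ : DecidableEquality Point
_≟ₚ_ = ProdP.≡-dec FinP._≟_ (ProdP.≡-dec FinP._≟_ FinP._≟_)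

allF₃ : List F₃
allF₃ = zero ∷ suc zero ∷ suc (suc zero) ∷ []

allPoints : List Point
allPoints = concatMap (λ a → concatMap (λ b → Data.List.map (λ c → (a , b , c)) allF₃) allF₃) allF₃

-- A line of AG(3,F_3) is given by a base point p and a nonzero direction d;
-- its point set is {p, p + d, p + 2d}.
OnLine : Point → Point → Point → Set
OnLine p d x = (x ≡ p) ⊎ ((x ≡ p +ᵥ d) ⊎ (x ≡ (p +ᵥ d) +ᵥ d))

onLine? : ∀ p d x → Dec (OnLine p d x)
onLine? p d x = (x ≟ₚ p) ⊎-dec ((x ≟ₚ (p +ᵥ d)) ⊎-dec (x ≟ₚ ((p +ᵥ d) +ᵥ d)))

-- A space isomorphic to AG(3,F_3) on the common point set `Point` is given by
-- a bijection σ : Point ↔ Point (an isomorphism from the standard AG(3,F_3));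
-- its lines are the images σ(L) of the lines L of the standard AG(3,F_3).
Space : Set
Space = Point ↔ Point

OnSpaceLine : Space → Point → Point → Point → Set
OnSpaceLine σ p d x = OnLine p d (Inverse.from σ x)

onSpaceLine? : ∀ σ p d x → Dec (OnSpaceLine σ p d x)
onSpaceLine? σ p d x = onLine? p d (Inverse.from σ x)

intersectionSize : Space → Point → Point → Space → Point → Point → ℕ
intersectionSize σ p d τ q e =
  length (filter (λ x → onSpaceLine? σ p d x ×-dec onSpaceLine? τ q e x) allPoints)

Orthogoval : Space → Space → Set
Orthogoval σ τ = ∀ p d q e → d ≢ 𝟎 → e ≢ 𝟎 → intersectionSize σ p d τ q e ≤ 2

MutuallyOrthogoval : {k : ℕ} → (Fin k → Space) → Set
MutuallyOrthogoval {k} S = ∀ (i j : Fin k) → i ≢ j → Orthogoval (S i) (S j)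

{-# OPTIONS --safe #-}
module Submission where

open import Defs
open import Data.Fin using (Fin; zero; suc; _≟_; combine)
open import Data.Fin.Properties using (all?; ¬∀⟶∃¬)
open import Data.List using (List; _∷_; map; filter; length; allFin)
open import Data.List.Properties using (length-removeAt′; filter-notAll)
open import Data.List.Membership.Propositional using (_∈_; _─_; lose)
open import Data.List.Membership.Propositional.Properties using (∈-map⁺; ∈-allFin; ∈-filter⁺; ∈-filter⁻)
open import Data.List.Relation.Binary.Subset.Propositional using (_⊆_)
open import Data.List.Relation.Unary.Any using (here; there; index)
open import Data.List.Relation.Unary.All as All using ()
open import Data.List.Relation.Unary.AllPairs using ([]; _∷_)
open import Data.List.Relation.Unary.Unique.Propositional using (Unique)
open import Data.List.Relation.Unary.Unique.Propositional.Properties using (filter⁺)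
open import Data.List.Relation.Unary.Unique.DecPropositional _≟ₚ_ using (unique?)
open import Data.Nat using (ℕ; suc; _≤_; _/_; z≤n; s≤s; s≤s⁻¹)
open import Data.Nat.DivMod using (_mod_)
open import Data.Nat.Properties using (module ≤-Reasoning)
open import Data.Product using (∃; _×_; _,_; uncurry)
open import Data.Product.Properties using (,-injectiveˡ; ,-injectiveʳ)
open import Data.Sum using (inj₁; inj₂)
open import Data.Vec using (Vec; []; _∷_; lookup)
open import Function using (_∘_)
open import Function.Bundles using (Inverse; Injection; mk↔ₛ′)
open import Function.Definitions using (StrictlyInverseˡ)
open import Function.Properties.Inverse using (↔-refl; ↔-trans; ↔-sym; ↔⇒↣)
open import Relation.Binary.PropositionalEquality using (_≡_; _≢_; refl; sym; trans; cong; cong₂; subst)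
open import Relation.Nullary using (Dec; ¬_; yes; no; contradiction)
open import Relation.Nullary.Decidable using (True; toWitness; from-yes; map′; ¬?; _×-dec_; _→-dec_)
open import Relation.Unary using (Pred; Decidable)

-- A line {q, q + e, q + 2e} of AG(3, F₃) sums to 3q + 3e = 𝟎, and so does any enumeration of
-- its three points.  Hence if τ⁻¹ ∘ σ sends no line to three points with sum 𝟎, no line of σ is
-- contained in a line of τ, and as each line of σ has three points, σ and τ are orthogoval.  The
-- eight spaces are explicit permutations of the points (the first being the standard space), and
-- the sum condition is checked exhaustively for each of the 56 ordered pairs.

module _ {a} {A : Set a} where

  ∈-─⁺ : ∀ {x y} {ys : List A} (x∈ys : x ∈ ys) → y ∈ ys → y ≢ x → y ∈ ys ─ x∈ys
  ∈-─⁺ (here refl)  (here refl)  y≢x = contradiction refl y≢x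
  ∈-─⁺ (here refl)  (there y∈ys) _   = y∈ys
  ∈-─⁺ (there _)    (here refl)  _   = here refl
  ∈-─⁺ (there x∈ys) (there y∈ys) y≢x = there (∈-─⁺ x∈ys y∈ys y≢x)

  Unique∧⊆⇒length≤ : ∀ {xs ys : List A} → Unique xs → xs ⊆ ys → length xs ≤ length ys
  Unique∧⊆⇒length≤ []                         _   = z≤n
  Unique∧⊆⇒length≤ {x ∷ xs} {ys} (x≢xs ∷ uxs) xs⊆ys = begin
    suc (length xs)            ≤⟨ s≤s (Unique∧⊆⇒length≤ uxs xs⊆ys─x) ⟩
    suc (length (ys ─ x∈ys))   ≡⟨ sym (length-removeAt′ ys (index x∈ys)) ⟩
    length ys                  ∎
    where
    open ≤-Reasoning
    x∈ys = xs⊆ys (here refl)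
    xs⊆ys─x : xs ⊆ ys ─ x∈ys
    xs⊆ys─x y∈xs = ∈-─⁺ x∈ys (xs⊆ys (there y∈xs)) (All.lookup x≢xs y∈xs ∘ sym)

lineCoord : F₃ → F₃ → F₃ → F₃
lineCoord a b zero             = a
lineCoord a b (suc zero)       = a ⊕ b
lineCoord a b (suc (suc zero)) = (a ⊕ b) ⊕ b

lineCoord-sum : ∀ a b i j k → i ≢ j → i ≢ k → j ≢ k →
                (lineCoord a b i ⊕ lineCoord a b j) ⊕ lineCoord a b k ≡ zero
lineCoord-sum = from-yes (all? λ a → all? λ b → all? λ i → all? λ j → all? λ k →
  ¬? (i ≟ j) →-dec ¬? (i ≟ k) →-dec ¬? (j ≟ k) →-dec
  ((lineCoord a b i ⊕ lineCoord a b j) ⊕ lineCoord a b k ≟ zero))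

lineCoord≡⇒b≡0 : ∀ a b s t → lineCoord a b s ≡ lineCoord a b t → s ≢ t → b ≡ zero
lineCoord≡⇒b≡0 = from-yes (all? λ a → all? λ b → all? λ s → all? λ t →
  (lineCoord a b s ≟ lineCoord a b t) →-dec ¬? (s ≟ t) →-dec (b ≟ zero))

linePoint : Point → Point → F₃ → Point
linePoint (a₁ , a₂ , a₃) (b₁ , b₂ , b₃) t = lineCoord a₁ b₁ t , lineCoord a₂ b₂ t , lineCoord a₃ b₃ t

OnLine⇒linePoint : ∀ {p d x} → OnLine p d x → ∃ λ t → x ≡ linePoint p d t
OnLine⇒linePoint {_ , _ , _} {_ , _ , _} (inj₁ refl)        = zero , refl
OnLine⇒linePoint {_ , _ , _} {_ , _ , _} (inj₂ (inj₁ refl)) = suc zero , refl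
OnLine⇒linePoint {_ , _ , _} {_ , _ , _} (inj₂ (inj₂ refl)) = suc (suc zero) , refl

linePoint-sum : ∀ q e {i j k} → i ≢ j → i ≢ k → j ≢ k →
                (linePoint q e i +ᵥ linePoint q e j) +ᵥ linePoint q e k ≡ 𝟎
linePoint-sum (a₁ , a₂ , a₃) (b₁ , b₂ , b₃) {i} {j} {k} i≢j i≢k j≢k =
  cong₂ _,_ (sum a₁ b₁) (cong₂ _,_ (sum a₂ b₂) (sum a₃ b₃))
  where sum = λ a b → lineCoord-sum a b i j k i≢j i≢k j≢k

linePoint-injective : ∀ p d {s t} → d ≢ 𝟎 → linePoint p d s ≡ linePoint p d t → s ≡ t
linePoint-injective (a₁ , a₂ , a₃) (b₁ , b₂ , b₃) {s} {t} d≢𝟎 eq with s ≟ t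
... | yes s≡t = s≡t
... | no s≢t  = contradiction (cong₂ _,_ (zero-at a₁ b₁ (,-injectiveˡ eq))
                  (cong₂ _,_ (zero-at a₂ b₂ (,-injectiveˡ (,-injectiveʳ eq)))
                             (zero-at a₃ b₃ (,-injectiveʳ (,-injectiveʳ eq))))) d≢𝟎
  where zero-at = λ a b eqᵢ → lineCoord≡⇒b≡0 a b s t eqᵢ s≢t

collinear-sum : ∀ {q e x y z} → OnLine q e x → OnLine q e y → OnLine q e z →
                x ≢ y → x ≢ z → y ≢ z → (x +ᵥ y) +ᵥ z ≡ 𝟎
collinear-sum {q} {e} x∈ y∈ z∈ x≢y x≢z y≢z
  with i , refl ← OnLine⇒linePoint x∈
     | j , refl ← OnLine⇒linePoint y∈
     | k , refl ← OnLine⇒linePoint z∈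
  = linePoint-sum q e {i} {j} {k} (x≢y ∘ cong (linePoint q e)) (x≢z ∘ cong (linePoint q e))
                                  (y≢z ∘ cong (linePoint q e))

all-Point? : ∀ {ℓ} {P : Pred Point ℓ} → Decidable P → Dec (∀ x → P x)
all-Point? P? = map′ (λ ∀P (a , b , c) → ∀P a b c) (λ ∀P a b c → ∀P (a , b , c))
                     (all? λ a → all? λ b → all? λ c → P? (a , b , c))

allPoints-unique : Unique allPoints
allPoints-unique = from-yes (unique? allPoints)

spaceLinePoint : Space → Point → Point → F₃ → Point
spaceLinePoint σ p d = Inverse.to σ ∘ linePoint p d

spaceLine : Space → Point → Point → List Point
spaceLine σ p d = map (spaceLinePoint σ p d) (allFin 3)

∈-spaceLine : ∀ σ p d t → spaceLinePoint σ p d t ∈ spaceLine σ p d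
∈-spaceLine σ p d t = ∈-map⁺ (spaceLinePoint σ p d) (∈-allFin t)

onBothLines? : ∀ σ p d τ q e → Decidable (λ x → OnSpaceLine σ p d x × OnSpaceLine τ q e x)
onBothLines? σ p d τ q e x = onSpaceLine? σ p d x ×-dec onSpaceLine? τ q e x

intersection⊆lineImage : ∀ σ p d τ q e →
  filter (onBothLines? σ p d τ q e) allPoints ⊆
  filter (onSpaceLine? τ q e) (spaceLine σ p d)
intersection⊆lineImage σ p d τ q e {x} x∈
  with _ , on-σ , on-τ ← ∈-filter⁻ (onBothLines? σ p d τ q e) x∈
  with t , from-x≡ ← OnLine⇒linePoint on-σ
  = ∈-filter⁺ (onSpaceLine? τ q e) (subst (_∈ spaceLine σ p d) x≡ (∈-spaceLine σ p d t)) on-τ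
  where
  x≡ : spaceLinePoint σ p d t ≡ x
  x≡ = trans (cong (Inverse.to σ) (sym from-x≡)) (Inverse.strictlyInverseˡ σ x)

intersectionSize≤2 : ∀ σ p d τ q e t → ¬ OnSpaceLine τ q e (spaceLinePoint σ p d t) →
                     intersectionSize σ p d τ q e ≤ 2
intersectionSize≤2 σ p d τ q e t t-off-τ-line = s≤s⁻¹ (begin-strict
  intersectionSize σ p d τ q e
    ≤⟨ Unique∧⊆⇒length≤ (filter⁺ (onBothLines? σ p d τ q e) allPoints-unique)
                        (intersection⊆lineImage σ p d τ q e) ⟩
  length (filter (onSpaceLine? τ q e) (spaceLine σ p d))
    <⟨ filter-notAll (onSpaceLine? τ q e) (spaceLine σ p d) (lose (∈-spaceLine σ p d t) t-off-τ-line) ⟩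
  length (spaceLine σ p d)
    ∎)
  where open ≤-Reasoning

imageSum : (Point → Point) → Point → Point → Point
imageSum f p d =
  (f (linePoint p d zero) +ᵥ f (linePoint p d (suc zero))) +ᵥ f (linePoint p d (suc (suc zero)))

LineImageSumsNonzero : (Point → Point) → Set
LineImageSumsNonzero f = ∀ p d → d ≢ 𝟎 → imageSum f p d ≢ 𝟎

lineImageSumsNonzero? : ∀ f → Dec (LineImageSumsNonzero f)
lineImageSumsNonzero? f = all-Point? λ p → all-Point? λ d → ¬? (d ≟ₚ 𝟎) →-dec ¬? (imageSum f p d ≟ₚ 𝟎)

LineImageSumsNonzero⇒Orthogoval : ∀ σ τ → LineImageSumsNonzero (Inverse.from τ ∘ Inverse.to σ) →
                                  Orthogoval σ τ
LineImageSumsNonzero⇒Orthogoval σ τ nonzero p d q e d≢𝟎 _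
  with all? (onSpaceLine? τ q e ∘ spaceLinePoint σ p d)
... | no not-all-on-τ-line = uncurry (intersectionSize≤2 σ p d τ q e)
  (¬∀⟶∃¬ 3 _ (onSpaceLine? τ q e ∘ spaceLinePoint σ p d) not-all-on-τ-line)
... | yes on-τ-line =
  contradiction (collinear-sum (on-τ-line zero) (on-τ-line (suc zero)) (on-τ-line (suc (suc zero)))
                               (distinct zero (suc zero) λ ()) (distinct zero (suc (suc zero)) λ ())
                               (distinct (suc zero) (suc (suc zero)) λ ()))
                (nonzero p d d≢𝟎)
  where
  distinct : ∀ s t → s ≢ t →
             Inverse.from τ (spaceLinePoint σ p d s) ≢ Inverse.from τ (spaceLinePoint σ p d t)
  distinct _ _ s≢t =
    s≢t ∘ linePoint-injective p d d≢𝟎 ∘ Injection.injective (↔⇒↣ (↔-trans σ (↔-sym τ)))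

-- Entry n of a table stands for the point (n / 9, (n / 3) mod 3, n mod 3); entries are listed in
-- the order of allPoints.
Table : Set
Table = Vec ℕ 27

applyTable : Table → Point → Point
applyTable t (a , b , c) = (n / 9) mod 3 , (n / 3) mod 3 , n mod 3
  where n = lookup t (combine a (combine b c))

strictlyInverseˡ? : ∀ t u → Dec (StrictlyInverseˡ _≡_ (applyTable t) (applyTable u))
strictlyInverseˡ? t u = all-Point? λ x → applyTable t (applyTable u x) ≟ₚ x

tableSpace : (t u : Table) → {True (strictlyInverseˡ? t u)} → {True (strictlyInverseˡ? u t)} → Space
tableSpace t u {tu} {ut} = mk↔ₛ′ (applyTable t) (applyTable u) (toWitness tu) (toWitness ut)

spaces : Fin 8 → Space
spaces = lookup (↔-refl
  ∷ tableSpace ( 12 ∷ 26 ∷ 18 ∷  4 ∷  0 ∷ 22 ∷ 20 ∷  6 ∷  1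
               ∷  5 ∷ 11 ∷ 10 ∷ 19 ∷ 15 ∷ 24 ∷  2 ∷ 21 ∷ 25
               ∷  7 ∷ 14 ∷  9 ∷  3 ∷ 13 ∷ 16 ∷ 23 ∷ 17 ∷  8 ∷ [])
               (  4 ∷  8 ∷ 15 ∷ 21 ∷  3 ∷  9 ∷  7 ∷ 18 ∷ 26
               ∷ 20 ∷ 11 ∷ 10 ∷  0 ∷ 22 ∷ 19 ∷ 13 ∷ 23 ∷ 25
               ∷  2 ∷ 12 ∷  6 ∷ 16 ∷  5 ∷ 24 ∷ 14 ∷ 17 ∷  1 ∷ [])
  ∷ tableSpace (  3 ∷ 21 ∷  5 ∷  2 ∷ 11 ∷  4 ∷ 24 ∷ 22 ∷ 15
               ∷  7 ∷ 13 ∷ 20 ∷  0 ∷  6 ∷ 10 ∷ 14 ∷  8 ∷ 16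
               ∷ 19 ∷  1 ∷ 12 ∷ 25 ∷  9 ∷ 23 ∷ 17 ∷ 18 ∷ 26 ∷ [])
               ( 12 ∷ 19 ∷  3 ∷  0 ∷  5 ∷  2 ∷ 13 ∷  9 ∷ 16
               ∷ 22 ∷ 14 ∷  4 ∷ 20 ∷ 10 ∷ 15 ∷  8 ∷ 17 ∷ 24
               ∷ 25 ∷ 18 ∷ 11 ∷  1 ∷  7 ∷ 23 ∷  6 ∷ 21 ∷ 26 ∷ [])
  ∷ tableSpace ( 21 ∷ 14 ∷ 24 ∷  2 ∷ 16 ∷ 15 ∷  5 ∷ 12 ∷ 23
               ∷  7 ∷ 10 ∷  4 ∷ 25 ∷  6 ∷  8 ∷ 13 ∷ 20 ∷ 18
               ∷  0 ∷ 19 ∷ 26 ∷ 17 ∷  1 ∷  3 ∷  9 ∷ 22 ∷ 11 ∷ [])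
               ( 18 ∷ 22 ∷  3 ∷ 23 ∷ 11 ∷  6 ∷ 13 ∷  9 ∷ 14
               ∷ 24 ∷ 10 ∷ 26 ∷  7 ∷ 15 ∷  1 ∷  5 ∷  4 ∷ 21
               ∷ 17 ∷ 19 ∷ 16 ∷  0 ∷ 25 ∷  8 ∷  2 ∷ 12 ∷ 20 ∷ [])
  ∷ tableSpace ( 12 ∷ 16 ∷ 19 ∷  4 ∷ 23 ∷ 17 ∷ 11 ∷ 18 ∷ 10
               ∷ 14 ∷ 20 ∷ 15 ∷ 26 ∷  5 ∷ 13 ∷  0 ∷ 24 ∷  8
               ∷  1 ∷ 25 ∷  2 ∷ 21 ∷  9 ∷ 22 ∷  6 ∷  7 ∷  3 ∷ [])
               ( 15 ∷ 18 ∷ 20 ∷ 26 ∷  3 ∷ 13 ∷ 24 ∷ 25 ∷ 17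
               ∷ 22 ∷  8 ∷  6 ∷  0 ∷ 14 ∷  9 ∷ 11 ∷  1 ∷  5
               ∷  7 ∷  2 ∷ 10 ∷ 21 ∷ 23 ∷  4 ∷ 16 ∷ 19 ∷ 12 ∷ [])
  ∷ tableSpace (  0 ∷ 10 ∷ 15 ∷  9 ∷ 22 ∷ 18 ∷  1 ∷ 17 ∷  8
               ∷ 26 ∷  4 ∷ 23 ∷  7 ∷  6 ∷ 25 ∷ 12 ∷  5 ∷ 21
               ∷ 24 ∷ 14 ∷ 19 ∷ 13 ∷ 16 ∷ 20 ∷  3 ∷ 11 ∷  2 ∷ [])
               (  0 ∷  6 ∷ 26 ∷ 24 ∷ 10 ∷ 16 ∷ 13 ∷ 12 ∷  8
               ∷  3 ∷  1 ∷ 25 ∷ 15 ∷ 21 ∷ 19 ∷  2 ∷ 22 ∷  7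
               ∷  5 ∷ 20 ∷ 23 ∷ 17 ∷  4 ∷ 11 ∷ 18 ∷ 14 ∷  9 ∷ [])
  ∷ tableSpace ( 25 ∷ 20 ∷  5 ∷ 10 ∷ 14 ∷ 11 ∷ 19 ∷  7 ∷  9
               ∷ 12 ∷ 16 ∷ 23 ∷  8 ∷ 15 ∷ 21 ∷ 13 ∷ 18 ∷  4
               ∷  3 ∷  2 ∷  0 ∷ 17 ∷ 22 ∷ 24 ∷ 26 ∷  1 ∷  6 ∷ [])
               ( 20 ∷ 25 ∷ 19 ∷ 18 ∷ 17 ∷  2 ∷ 26 ∷  7 ∷ 12
               ∷  8 ∷  3 ∷  5 ∷  9 ∷ 15 ∷  4 ∷ 13 ∷ 10 ∷ 21
               ∷ 16 ∷  6 ∷  1 ∷ 14 ∷ 22 ∷ 11 ∷ 23 ∷  0 ∷ 24 ∷ [])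
  ∷ tableSpace ( 25 ∷ 26 ∷  7 ∷  5 ∷ 13 ∷  0 ∷  4 ∷ 20 ∷ 18
               ∷ 23 ∷  3 ∷ 21 ∷ 17 ∷ 12 ∷  6 ∷ 14 ∷ 22 ∷  8
               ∷ 11 ∷ 24 ∷  1 ∷  2 ∷ 10 ∷ 16 ∷ 15 ∷  9 ∷ 19 ∷ [])
               (  5 ∷ 20 ∷ 21 ∷ 10 ∷  6 ∷  3 ∷ 14 ∷  2 ∷ 17
               ∷ 25 ∷ 22 ∷ 18 ∷ 13 ∷  4 ∷ 15 ∷ 24 ∷ 23 ∷ 12
               ∷  8 ∷ 26 ∷  7 ∷ 11 ∷ 16 ∷  9 ∷ 19 ∷  0 ∷  1 ∷ [])
  ∷ [])

mainTheorem7 : ∃ λ (S : Fin 8 → Space) → MutuallyOrthogoval S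
mainTheorem7 = spaces , λ i j i≢j →
  LineImageSumsNonzero⇒Orthogoval (spaces i) (spaces j) (pairwise i j i≢j)
  where
  pairwise : ∀ i j → i ≢ j → LineImageSumsNonzero (Inverse.from (spaces j) ∘ Inverse.to (spaces i))
  pairwise = from-yes (all? λ i → all? λ j → ¬? (i ≟ j) →-dec
                       lineImageSumsNonzero? (Inverse.from (spaces j) ∘ Inverse.to (spaces i)))
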